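{- Let $\mathbb{F}$ be a field of characteristic $2$. For every $w\in W^{(2)}$ there is a cycle in $\widetilde H_3(\mathbb{F})$ whose voltage (with respect to $\ell$) is $w$.
   Context: Let $V=\mathbb{F}^4$, $V^*$ its dual. $\widetilde H_3(\mathbb{F})$: vertices are pure tensors $v\otimes f\in V\otimes V^*$ with $f(v)\neq0$; $v\otimes f$ and $w\otimes g$ are adjacent iff $f(w)=g(v)=0$. Let $W=\bigwedge^2V$; fix an isomorphism $\chi:\bigwedge^4V\to\mathbb{F}$; identify $\bigwedge^2V^*$ with $W^*$ via $(f_1\wedge f_2)(v_1\wedge v_2)=f_1(v_1)f_2(v_2)-f_1(v_2)f_2(v_1)$; let $\psi:W\to W^*$ be $\psi(\hat w)(\hat v)=\chi(\hat v\wedge\hat w)$, and $\phi:\bigwedge^2V^*\to W$ the inverse of $\psi$ composed with this identification. $S_2(W)$ is the symmetric square of $W$ with product $xy$, $x^2=xx$; $W^{(2)}$ is the $\mathbb{F}$-linear span of $\{\hat w^2:\hat w\in W\}$. The voltage assignment $\ell$ assigns to the dart from $v_1\otimes h_1$ to $v_2\otimes h_2$ the element $h_1(v_1)^{ -1}h_2(v_2)^{ -1}(v_1\wedge v_2)(h_1\wedge h_2)^\phi\in S_2(W)$. A cycle is a closed walk, i.e. a sequence $u_0,u_1,\dots,u_k=u_0$ of vertices with $u_{i-1}$ adjacent to $u_i$ (vertices may repeat); its voltage is $\sum_{i=1}^k\ell(u_{i-1},u_i)$. -}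

module Defs where

open import Level using (Level; _⊔_) renaming (suc to lsuc)
open import Algebra.Bundles using (CommutativeRing)
open import Data.Fin using (Fin; zero; suc; _≟_)
open import Data.Product using (_×_; _,_; ∃; Σ-syntax)
open import Data.List using (List; []; _∷_; _++_; [_])
open import Data.List.Relation.Unary.Linked using (Linked)
open import Relation.Nullary using (¬_; yes; no)

record Field (c ℓ : Level) : Set (lsuc (c ⊔ ℓ)) where
  field
    commutativeRing : CommutativeRing c ℓ
  open CommutativeRing commutativeRing public
  field
    _⁻¹      : Carrier → Carrier
    1≉0      : ¬ (1# ≈ 0#)
    ⁻¹-inverse : ∀ x → ¬ (x ≈ 0#) → x * (x ⁻¹) ≈ 1#

module Setup {c ℓ : Level} (F : Field c ℓ) where
  open Field F using (Carrier; _≈_; _+_; _*_; _-_; 0#; 1#; _⁻¹)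

  Char2 : Set ℓ
  Char2 = 1# + 1# ≈ 0#

  -- V = F^4 and V* = F^4 (coordinates w.r.t. the standard basis e_0..e_3 and its dual basis).
  V : Set c
  V = Fin 4 → Carrier

  V* : Set c
  V* = Fin 4 → Carrier

  ev : V* → V → Carrier
  ev f v = f zero * v zero + f (suc zero) * v (suc zero)
         + f (suc (suc zero)) * v (suc (suc zero))
         + f (suc (suc (suc zero))) * v (suc (suc (suc zero)))

  -- Index of the 6 basis 2-vectors e_i ∧ e_j (i < j), in the order
  -- 01, 02, 03, 12, 13, 23.
  pr : Fin 6 → Fin 4 × Fin 4
  pr zero = (zero , suc zero)
  pr (suc zero) = (zero , suc (suc zero))
  pr (suc (suc zero)) = (zero , suc (suc (suc zero)))
  pr (suc (suc (suc zero))) = (suc zero , suc (suc zero))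
  pr (suc (suc (suc (suc zero)))) = (suc zero , suc (suc (suc zero)))
  pr (suc (suc (suc (suc (suc zero))))) = (suc (suc zero) , suc (suc (suc zero)))

  -- W = Λ²V, coordinates w.r.t. the basis e_i ∧ e_j (i < j).
  W : Set c
  W = Fin 6 → Carrier

  Λ²V* : Set c
  Λ²V* = Fin 6 → Carrier

  wedge : (Fin 4 → Carrier) → (Fin 4 → Carrier) → (Fin 6 → Carrier)
  wedge a b p with pr p
  ... | (i , j) = a i * b j - a j * b i

  w01 w02 w03 w12 w13 w23 : W → Carrier
  w01 x = x zero
  w02 x = x (suc zero)
  w03 x = x (suc (suc zero))
  w12 x = x (suc (suc (suc zero)))
  w13 x = x (suc (suc (suc (suc zero))))
  w23 x = x (suc (suc (suc (suc (suc zero)))))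

  -- Coefficient of e₀∧e₁∧e₂∧e₃ in x ∧ y ∈ Λ⁴V, for x, y ∈ W = Λ²V.
  top : W → W → Carrier
  top x y = w01 x * w23 y - w02 x * w13 y + w03 x * w12 y
          + w12 x * w03 y - w13 x * w02 y + w23 x * w01 y

  -- The isomorphism χ : Λ⁴V → F is determined by the nonzero scalar
  -- χ₀ = χ(e₀∧e₁∧e₂∧e₃); χ(x ∧ y) = χ₀ · top x y.
  -- ψ : W → W*,  ψ(ŵ)(v̂) = χ(v̂ ∧ ŵ).
  ψ : Carrier → W → (W → Carrier)
  ψ χ₀ ŵ v̂ = χ₀ * top v̂ ŵ

  pair : (Fin 6 → Carrier) → (Fin 6 → Carrier) → Carrier
  pair a x = w01 a * w01 x + w02 a * w02 x + w03 a * w03 x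
           + w12 a * w12 x + w13 a * w13 x + w23 a * w23 x

  -- Identification Λ²V* ≅ W*: an element of Λ²V* in the basis e_i*∧e_j*
  -- acts on W by the pairing (this agrees with
  -- (f₁∧f₂)(v₁∧v₂) = f₁(v₁)f₂(v₂) − f₁(v₂)f₂(v₁)).
  ι : Λ²V* → (W → Carrier)
  ι = pair

  -- φ : Λ²V* → W is the inverse of ψ composed with the identification,
  -- i.e. ψ(φ a) = ι a as functionals on W.
  IsPhi : Carrier → (Λ²V* → W) → Set (c ⊔ ℓ)
  IsPhi χ₀ φ = ∀ (a : Λ²V*) (x : W) → ψ χ₀ (φ a) x ≈ ι a x

  -- S₂(W): coordinates w.r.t. the monomial basis e_p e_q, stored as a
  -- symmetric function Fin 6 → Fin 6 → F (entry (p,q) = entry (q,p) =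
  -- coefficient of the monomial e_p e_q).
  S₂ : Set c
  S₂ = Fin 6 → Fin 6 → Carrier

  _≈S_ : S₂ → S₂ → Set ℓ
  s ≈S t = ∀ p q → s p q ≈ t p q

  0S : S₂
  0S p q = 0#

  _+S_ : S₂ → S₂ → S₂
  (s +S t) p q = s p q + t p q

  _·S_ : Carrier → S₂ → S₂
  (λ₀ ·S s) p q = λ₀ * s p q

  mul : W → W → S₂
  mul x y p q with p ≟ q
  ... | yes _ = x p * y p
  ... | no  _ = x p * y q + x q * y p

  sq : W → S₂
  sq x = mul x x

  lincomb : List (Carrier × W) → S₂
  lincomb [] = 0S
  lincomb ((a , x) ∷ rest) = (a ·S sq x) +S lincomb rest

  InW2 : S₂ → Set (c ⊔ ℓ)
  InW2 w = ∃ λ (cs : List (Carrier × W)) → w ≈S lincomb cs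

  -- Vertices of H̃₃(F): pure tensors v ⊗ f with f(v) ≠ 0, represented by the pair (v , f).
  record Vertex : Set (c ⊔ ℓ) where
    constructor mkV
    field
      vec  : V
      form : V*
      nz   : ¬ (ev form vec ≈ 0#)
  open Vertex public

  Adj : Vertex → Vertex → Set ℓ
  Adj x y = (ev (form x) (vec y) ≈ 0#) × (ev (form y) (vec x) ≈ 0#)

  volt : Carrier → (Λ²V* → W) → Vertex → Vertex → S₂
  volt χ₀ φ x y =
    (((ev (form x) (vec x)) ⁻¹) * ((ev (form y) (vec y)) ⁻¹))
      ·S mul (wedge (vec x) (vec y)) (φ (wedge (form x) (form y)))

  walkVolt : Carrier → (Λ²V* → W) → List Vertex → S₂
  walkVolt χ₀ φ [] = 0S
  walkVolt χ₀ φ (x ∷ []) = 0S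
  walkVolt χ₀ φ (x ∷ y ∷ rest) = volt χ₀ φ x y +S walkVolt χ₀ φ (y ∷ rest)

  closedWalk : Vertex → List Vertex → List Vertex
  closedWalk u₀ us = u₀ ∷ (us ++ [ u₀ ])

  HasCycleWithVoltage : Carrier → (Λ²V* → W) → S₂ → Set (c ⊔ ℓ)
  HasCycleWithVoltage χ₀ φ w =
    Σ[ u₀ ∈ Vertex ] Σ[ us ∈ List Vertex ]
      (Linked Adj (closedWalk u₀ us) × (walkVolt χ₀ φ (closedWalk u₀ us) ≈S w))

-- In characteristic 2, (Σ x_p e_p)² = Σ x_p² e_p², so W^(2) consists of the diagonal elements
-- Σ d_p e_p² of S₂(W), and concatenating closed walks at one vertex adds their voltages; it
-- therefore suffices to realise every x·e_p² by a closed walk at e₀ ⊗ e₀*.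
-- If α, β are dual to a, b and γ, δ vanish on a and b, the 4-cycle a⊗α, b⊗β, a⊗(α+γ), b⊗(β+δ)
-- has voltage (a∧b)(γ∧δ)^φ: every dart carries a∧b (signs are irrelevant), and the form parts
-- add up to γ∧δ. For a∧b = e_i∧e_j and γ∧δ a multiple of the complementary e_k*∧e_l*, whose
-- image under φ is a multiple of e_i∧e_j, this voltage is x·e_p². Going back and forth along an
-- edge u–v adds ℓ(u,v) + ℓ(v,u) = 0, which moves these cycles to the common base vertex.
module Submission where

open import Defs
open import Level using (Level; _⊔_)
open import Algebra.Bundles using (CommutativeRing; Semiring)
open import Algebra.Solver.Ring.AlmostCommutativeRing
  using (_-Raw-AlmostCommutative⟶_; fromCommutativeRing)
import Algebra.Properties.Ring as RingProperties
import Algebra.Properties.CommutativeMonoid.Sum as CommutativeMonoidSum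
open import Data.Bool as Bool using (Bool; true; false; if_then_else_; _∧_; _xor_)
open import Data.Bool.Properties using (xor-∧-commutativeRing)
open import Data.Fin as Fin using (Fin; _≟_; punchIn)
open import Data.Fin.Patterns using (0F; 1F; 2F; 3F; 4F; 5F)
open import Data.Fin.Properties using (all?; punchInᵢ≢i)
open import Data.List using (List; []; _∷_; _++_; [_])
open import Data.List.Properties using (++-assoc)
open import Data.List.Relation.Unary.Linked using (Linked; []; [-]; _∷_)
open import Data.Maybe using (Maybe; just; nothing)
open import Data.Nat using (ℕ)
open import Data.Empty using (⊥-elim)
open import Data.Product using (_×_; _,_; proj₁; proj₂; swap; Σ-syntax)
open import Data.Vec.Functional using (zipWith; map)
open import Function using (_∘_)
open import Relation.Nullary using (¬_; Dec; does; yes; no)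
open import Relation.Nullary.Decidable using (dec-true; dec-false; from-yes; ¬?)
open import Relation.Binary.PropositionalEquality as ≡ using (_≡_; _≢_)

module Kronecker {c ℓ} (R : Semiring c ℓ) where
  open Semiring R
  open CommutativeMonoidSum +-commutativeMonoid
    using (sum; sum-syntax; sum-remove; sum-cong-≋; sum-replicate-zero)
  open import Relation.Binary.Reasoning.Setoid setoid

  bit : Bool → Carrier
  bit b = if b then 1# else 0#

  e : ∀ {n} → Fin n → Fin n → Carrier
  e s t = bit (does (s ≟ t))

  e-diag : ∀ {n} (s : Fin n) → e s s ≡ 1#
  e-diag s = ≡.cong bit (dec-true (s ≟ s) ≡.refl)

  e-≢ : ∀ {n} {s t : Fin n} → s ≢ t → e s t ≡ 0#
  e-≢ {s = s} {t} s≢t = ≡.cong bit (dec-false (s ≟ t) s≢t)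

  e-comm : ∀ {n} (s t : Fin n) → e s t ≡ e t s
  e-comm s t = by-cases (s ≟ t)
    where
    by-cases : Dec (s ≡ t) → e s t ≡ e t s
    by-cases (yes ≡.refl) = ≡.refl
    by-cases (no s≢t) = ≡.trans (e-≢ s≢t) (≡.sym (e-≢ (s≢t ∘ ≡.sym)))

  bit-idem : ∀ b → bit b * bit b ≈ bit b
  bit-idem false = zeroˡ 0#
  bit-idem true = *-identityˡ 1#

  sum-zero : ∀ {n} (g : Fin n → Carrier) → (∀ t → g t ≈ 0#) → sum g ≈ 0#
  sum-zero {n} g g≈0 = trans (sum-cong-≋ g≈0) (sum-replicate-zero n)

  ∑-e : ∀ {n} (f : Fin n → Carrier) s → ∑[ t < n ] (f t * e s t) ≈ f s
  ∑-e {ℕ.suc n} f s = begin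
    ∑[ t < ℕ.suc n ] (f t * e s t)                          ≈⟨ sum-remove {i = s} (λ t → f t * e s t) ⟩
    f s * e s s + ∑[ t < n ] (f (punchIn s t) * e s (punchIn s t))
      ≈⟨ +-cong (*-congˡ (reflexive (e-diag s))) (sum-zero _ off-s) ⟩
    f s * 1# + 0#                                           ≈⟨ +-identityʳ _ ⟩
    f s * 1#                                                ≈⟨ *-identityʳ _ ⟩
    f s                                                     ∎
    where
    off-s : ∀ t → f (punchIn s t) * e s (punchIn s t) ≈ 0#
    off-s t = trans (*-congˡ (reflexive (e-≢ (punchInᵢ≢i s t ∘ ≡.sym)))) (zeroʳ _)

Characteristic2 : ∀ {c ℓ} → CommutativeRing c ℓ → Set ℓ
Characteristic2 R = 1# + 1# ≈ 0#
  where open CommutativeRing R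

-- With coefficients in 𝔽₂ = (Bool, xor, ∧) the ring solver decides the identities of
-- commutative rings of characteristic 2.
module Char2RingSolver {c ℓ} (R : CommutativeRing c ℓ) (char2 : Characteristic2 R) where
  open CommutativeRing R

  open Kronecker semiring using (bit)
  open RingProperties ring using (-0#≈0#; +-inverseˡ-unique)

  bit-homomorphism : CommutativeRing.rawRing xor-∧-commutativeRing
                       -Raw-AlmostCommutative⟶ fromCommutativeRing R
  bit-homomorphism = record
    { ⟦_⟧    = bit
    ; +-homo = λ { false false → sym (+-identityʳ 0#) ; false true → sym (+-identityˡ 1#)
                 ; true false → sym (+-identityʳ 1#)  ; true true → sym char2 }
    ; *-homo = λ { false y → sym (zeroˡ (bit y)) ; true y → sym (*-identityˡ (bit y)) }
    ; -‿homo = λ { false → sym -0#≈0# ; true → +-inverseˡ-unique 1# 1# char2 }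
    ; 0-homo = refl
    ; 1-homo = refl
    }

  private
    bit-≟ : ∀ a b → Maybe (bit a ≈ bit b)
    bit-≟ a b with a Bool.≟ b
    ... | yes ≡.refl = just refl
    ... | no _ = nothing

  open import Algebra.Solver.Ring _ _ bit-homomorphism bit-≟ public

  𝟘 : ∀ {n} → Polynomial n
  𝟘 = con false

Linked-join : ∀ {a r} {A : Set a} {R : A → A → Set r} xs {y : A} ys →
              Linked R (xs ++ [ y ]) → Linked R (y ∷ ys) → Linked R (xs ++ y ∷ ys)
Linked-join []               ys _           y-ys = y-ys
Linked-join (x ∷ [])         ys (xy ∷ [-])  y-ys = xy ∷ y-ys
Linked-join (x ∷ x′ ∷ xs)    ys (xx′ ∷ rest) y-ys = xx′ ∷ Linked-join (x′ ∷ xs) ys rest y-ys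

module Walks {c ℓ} (F : Field c ℓ) (χ₀ : Field.Carrier F) (φ : Setup.Λ²V* F → Setup.W F) where
  open Field F
  open Setup F
  open CommutativeMonoidSum +-commutativeMonoid using (sum; sum-syntax)

  ClosedWalk : Vertex → S₂ → Set (c ⊔ ℓ)
  ClosedWalk u A = Σ[ us ∈ List Vertex ]
    (Linked Adj (closedWalk u us) × (walkVolt χ₀ φ (closedWalk u us) ≈S A))

  closed-walk : ∀ {u A} us {xs} → xs ≡ closedWalk u us →
                Linked Adj xs → walkVolt χ₀ φ xs ≈S A → ClosedWalk u A
  closed-walk us ≡.refl linked voltage = us , linked , voltage

  ClosedWalk-cong : ∀ {u A B} → ClosedWalk u A → A ≈S B → ClosedWalk u B
  ClosedWalk-cong (us , linked , voltage) A≈B = us , linked , λ p q → trans (voltage p q) (A≈B p q)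

  walkVolt-++ : ∀ xs y ys →
                walkVolt χ₀ φ (xs ++ y ∷ ys) ≈S (walkVolt χ₀ φ (xs ++ [ y ]) +S walkVolt χ₀ φ (y ∷ ys))
  walkVolt-++ []            y ys p q = sym (+-identityˡ _)
  walkVolt-++ (x ∷ [])      y ys p q = sym (+-congʳ (+-identityʳ _))
  walkVolt-++ (x ∷ x′ ∷ xs) y ys p q = trans (+-congˡ (walkVolt-++ (x′ ∷ xs) y ys p q)) (sym (+-assoc _ _ _))

  ClosedWalk-+ : ∀ {u A B} → ClosedWalk u A → ClosedWalk u B → ClosedWalk u (A +S B)
  ClosedWalk-+ {u} (us , linked , voltage) (us′ , linked′ , voltage′) =
    closed-walk (us ++ u ∷ us′) (≡.cong (u ∷_) (≡.sym (++-assoc us (u ∷ us′) [ u ])))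
      (Linked-join (u ∷ us) (us′ ++ [ u ]) linked linked′)
      (λ p q → trans (walkVolt-++ (u ∷ us) u (us′ ++ [ u ]) p q) (+-cong (voltage p q) (voltage′ p q)))

  ∑S : ∀ {n} → (Fin n → S₂) → S₂
  ∑S {n} M a b = ∑[ p < n ] M p a b

  ClosedWalk-∑ : ∀ {u n} (M : Fin (ℕ.suc n) → S₂) → (∀ p → ClosedWalk u (M p)) → ClosedWalk u (∑S M)
  ClosedWalk-∑ {n = ℕ.zero}  M walks = ClosedWalk-cong (walks 0F) (λ a b → sym (+-identityʳ _))
  ClosedWalk-∑ {n = ℕ.suc n} M walks = ClosedWalk-+ (walks 0F) (ClosedWalk-∑ (M ∘ Fin.suc) (walks ∘ Fin.suc))

module Char2 {c ℓ} (F : Field c ℓ) (char2 : Setup.Char2 F) where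
  open Field F
  open Setup F
  open Kronecker semiring using (bit; e; e-diag; e-≢; e-comm; bit-idem; sum-zero; ∑-e)
  open Char2RingSolver commutativeRing char2
  open _-Raw-AlmostCommutative⟶_ bit-homomorphism using (+-homo; *-homo)
  open CommutativeMonoidSum +-commutativeMonoid using (sum; sum-syntax; sum-cong-≋)
  open import Data.Vec.Functional.Relation.Binary.Equality.Setoid setoid using (_≋_)
  open import Relation.Binary.Reasoning.Setoid setoid

  infixl 6 _⊕_
  infixr 7 _⊛_

  _⊕_ : ∀ {n} → (Fin n → Carrier) → (Fin n → Carrier) → Fin n → Carrier
  _⊕_ = zipWith _+_

  _⊛_ : ∀ {n} → Carrier → (Fin n → Carrier) → Fin n → Carrier
  x ⊛ a = map (x *_) a

  pr₁ pr₂ : Fin 6 → Fin 4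
  pr₁ = proj₁ ∘ pr
  pr₂ = proj₂ ∘ pr

  -- pr (complement p) is the pair of indices complementary to pr p.
  complement : Fin 6 → Fin 6
  complement 0F = 5F
  complement 1F = 4F
  complement 2F = 3F
  complement 3F = 2F
  complement 4F = 1F
  complement 5F = 0F

  pr₂≢0 : ∀ p → 0F ≢ pr₂ p
  pr₂≢0 = from-yes (all? λ p → ¬? (0F ≟ pr₂ p))

  complement-distinct : ∀ p → pr₁ p ≢ pr₂ p × pr₁ (complement p) ≢ pr₁ p × pr₁ (complement p) ≢ pr₂ p
                              × pr₂ (complement p) ≢ pr₁ p × pr₂ (complement p) ≢ pr₂ p
  complement-distinct 0F = (λ ()) , (λ ()) , (λ ()) , (λ ()) , (λ ())
  complement-distinct 1F = (λ ()) , (λ ()) , (λ ()) , (λ ()) , (λ ())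
  complement-distinct 2F = (λ ()) , (λ ()) , (λ ()) , (λ ()) , (λ ())
  complement-distinct 3F = (λ ()) , (λ ()) , (λ ()) , (λ ()) , (λ ())
  complement-distinct 4F = (λ ()) , (λ ()) , (λ ()) , (λ ()) , (λ ())
  complement-distinct 5F = (λ ()) , (λ ()) , (λ ()) , (λ ()) , (λ ())

  complement-≟ : ∀ p r → does (complement p ≟ complement r) ≡ does (p ≟ r)
  complement-≟ = from-yes (all? λ p → all? λ r → does (complement p ≟ complement r) Bool.≟ does (p ≟ r))

  e-complement : ∀ p r → e (complement p) (complement r) ≡ e p r
  e-complement p r = ≡.cong bit (complement-≟ p r)

  xy+yx≈0 : ∀ x y → x * y + y * x ≈ 0#
  xy+yx≈0 = solve 2 (λ x y → x :* y :+ y :* x := 𝟘) refl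

  ev-∑ : ∀ f v → ev f v ≈ ∑[ t < 4 ] (f t * v t)
  ev-∑ f v = solve 8 (λ f₀ f₁ f₂ f₃ v₀ v₁ v₂ v₃ →
      f₀ :* v₀ :+ f₁ :* v₁ :+ f₂ :* v₂ :+ f₃ :* v₃
      := f₀ :* v₀ :+ (f₁ :* v₁ :+ (f₂ :* v₂ :+ (f₃ :* v₃ :+ 𝟘))))
    refl (f 0F) (f 1F) (f 2F) (f 3F) (v 0F) (v 1F) (v 2F) (v 3F)

  ev-e : ∀ f s → ev f (e s) ≈ f s
  ev-e f s = trans (ev-∑ f (e s)) (∑-e f s)

  ev-e-self : ∀ s → ev (e s) (e s) ≈ 1#
  ev-e-self s = trans (ev-e (e s) s) (reflexive (e-diag s))

  ev-e-≢ : ∀ {s t} → s ≢ t → ev (e s) (e t) ≈ 0#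
  ev-e-≢ {s} {t} s≢t = trans (ev-e (e s) t) (reflexive (e-≢ s≢t))

  ev-⊕ˡ : ∀ f g v → ev (f ⊕ g) v ≈ ev f v + ev g v
  ev-⊕ˡ f g v = solve 12 (λ f₀ f₁ f₂ f₃ g₀ g₁ g₂ g₃ v₀ v₁ v₂ v₃ →
      (f₀ :+ g₀) :* v₀ :+ (f₁ :+ g₁) :* v₁ :+ (f₂ :+ g₂) :* v₂ :+ (f₃ :+ g₃) :* v₃
      := (f₀ :* v₀ :+ f₁ :* v₁ :+ f₂ :* v₂ :+ f₃ :* v₃)
         :+ (g₀ :* v₀ :+ g₁ :* v₁ :+ g₂ :* v₂ :+ g₃ :* v₃))
    refl (f 0F) (f 1F) (f 2F) (f 3F) (g 0F) (g 1F) (g 2F) (g 3F) (v 0F) (v 1F) (v 2F) (v 3F)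

  wedge-antisym : ∀ a b → wedge b a ≋ wedge a b
  wedge-antisym a b r =
    solve 4 (λ aᵢ aⱼ bᵢ bⱼ → bᵢ :* aⱼ :- bⱼ :* aᵢ := aᵢ :* bⱼ :- aⱼ :* bᵢ) refl
      (a (pr₁ r)) (a (pr₂ r)) (b (pr₁ r)) (b (pr₂ r))

  wedge-⊛ˡ : ∀ x a b → wedge (x ⊛ a) b ≋ x ⊛ wedge a b
  wedge-⊛ˡ x a b r =
    solve 5 (λ x aᵢ aⱼ bᵢ bⱼ → x :* aᵢ :* bⱼ :- x :* aⱼ :* bᵢ := x :* (aᵢ :* bⱼ :- aⱼ :* bᵢ)) refl
      x (a (pr₁ r)) (a (pr₂ r)) (b (pr₁ r)) (b (pr₂ r))

  wedge-quadrilateral : ∀ α β γ δ →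
    wedge α β ⊕ (wedge β (α ⊕ γ) ⊕ (wedge (α ⊕ γ) (β ⊕ δ) ⊕ wedge (β ⊕ δ) α)) ≋ wedge γ δ
  wedge-quadrilateral α β γ δ r =
    solve 8 (λ αᵢ αⱼ βᵢ βⱼ γᵢ γⱼ δᵢ δⱼ →
        (αᵢ :* βⱼ :- αⱼ :* βᵢ)
        :+ ((βᵢ :* (αⱼ :+ γⱼ) :- βⱼ :* (αᵢ :+ γᵢ))
        :+ (((αᵢ :+ γᵢ) :* (βⱼ :+ δⱼ) :- (αⱼ :+ γⱼ) :* (βᵢ :+ δᵢ))
        :+ ((βᵢ :+ δᵢ) :* αⱼ :- (βⱼ :+ δⱼ) :* αᵢ)))
      := γᵢ :* δⱼ :- γⱼ :* δᵢ) refl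
      (α (pr₁ r)) (α (pr₂ r)) (β (pr₁ r)) (β (pr₂ r)) (γ (pr₁ r)) (γ (pr₂ r)) (δ (pr₁ r)) (δ (pr₂ r))

  bit-minor : ∀ s t u v → bit s * bit t - bit u * bit v ≈ bit ((s ∧ t) xor (u ∧ v))
  bit-minor s t u v = begin
    bit s * bit t - bit u * bit v  ≈⟨ solve 2 (λ x y → x :- y := x :+ y) refl (bit s * bit t) (bit u * bit v) ⟩
    bit s * bit t + bit u * bit v  ≈⟨ +-cong (*-homo s t) (*-homo u v) ⟨
    bit (s ∧ t) + bit (u ∧ v)      ≈⟨ +-homo (s ∧ t) (u ∧ v) ⟨
    bit ((s ∧ t) xor (u ∧ v))      ∎

  wedgeBit : Fin 4 → Fin 4 → Fin 6 → Bool
  wedgeBit i j r = (does (i ≟ pr₁ r) ∧ does (j ≟ pr₂ r)) xor (does (i ≟ pr₂ r) ∧ does (j ≟ pr₁ r))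

  wedgeBit-pr : ∀ p r → wedgeBit (pr₁ p) (pr₂ p) r ≡ does (p ≟ r)
  wedgeBit-pr = from-yes (all? λ p → all? λ r → wedgeBit (pr₁ p) (pr₂ p) r Bool.≟ does (p ≟ r))

  wedge-e : ∀ p → wedge (e (pr₁ p)) (e (pr₂ p)) ≋ e p
  wedge-e p r = trans (bit-minor _ _ _ _) (reflexive (≡.cong bit (wedgeBit-pr p r)))

  pair-∑ : ∀ a x → pair a x ≈ ∑[ t < 6 ] (a t * x t)
  pair-∑ a x = solve 12 (λ a₀ a₁ a₂ a₃ a₄ a₅ x₀ x₁ x₂ x₃ x₄ x₅ →
      a₀ :* x₀ :+ a₁ :* x₁ :+ a₂ :* x₂ :+ a₃ :* x₃ :+ a₄ :* x₄ :+ a₅ :* x₅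
      := a₀ :* x₀ :+ (a₁ :* x₁ :+ (a₂ :* x₂ :+ (a₃ :* x₃ :+ (a₄ :* x₄ :+ (a₅ :* x₅ :+ 𝟘))))))
    refl (a 0F) (a 1F) (a 2F) (a 3F) (a 4F) (a 5F) (x 0F) (x 1F) (x 2F) (x 3F) (x 4F) (x 5F)

  pair-e : ∀ a s → pair a (e s) ≈ a s
  pair-e a s = trans (pair-∑ a (e s)) (∑-e a s)

  top-pair : ∀ x y → top x y ≈ pair (x ∘ complement) y
  top-pair x y = solve 12 (λ x₀ x₁ x₂ x₃ x₄ x₅ y₀ y₁ y₂ y₃ y₄ y₅ →
      x₀ :* y₅ :- x₁ :* y₄ :+ x₂ :* y₃ :+ x₃ :* y₂ :- x₄ :* y₁ :+ x₅ :* y₀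
      := x₅ :* y₀ :+ x₄ :* y₁ :+ x₃ :* y₂ :+ x₂ :* y₃ :+ x₁ :* y₄ :+ x₀ :* y₅)
    refl (x 0F) (x 1F) (x 2F) (x 3F) (x 4F) (x 5F) (y 0F) (y 1F) (y 2F) (y 3F) (y 4F) (y 5F)

  top-e : ∀ r y → top (e (complement r)) y ≈ y r
  top-e r y = begin
    top (e (complement r)) y                            ≈⟨ top-pair (e (complement r)) y ⟩
    pair (e (complement r) ∘ complement) y              ≈⟨ pair-∑ (e (complement r) ∘ complement) y ⟩
    ∑[ t < 6 ] (e (complement r) (complement t) * y t)  ≈⟨ sum-cong-≋ reindex ⟩
    ∑[ t < 6 ] (y t * e r t)                            ≈⟨ ∑-e y r ⟩
    y r                                                 ∎
    where
    reindex : ∀ t → e (complement r) (complement t) * y t ≈ y t * e r t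
    reindex t = trans (*-comm _ _) (*-congˡ (reflexive (e-complement r t)))

  mul-cong : ∀ {x x′ y y′ : W} → x ≋ x′ → y ≋ y′ → mul x y ≈S mul x′ y′
  mul-cong x≋x′ y≋y′ p q with p ≟ q
  ... | yes _ = *-cong (x≋x′ p) (y≋y′ p)
  ... | no _  = +-cong (*-cong (x≋x′ p) (y≋y′ q)) (*-cong (x≋x′ q) (y≋y′ p))

  mul-⊕ʳ : ∀ x y y′ → (mul x y +S mul x y′) ≈S mul x (y ⊕ y′)
  mul-⊕ʳ x y y′ p q with p ≟ q
  ... | yes _ = sym (distribˡ (x p) (y p) (y′ p))
  ... | no _  = solve 6 (λ xp xq yp yq y′p y′q →
                  (xp :* yq :+ xq :* yp) :+ (xp :* y′q :+ xq :* y′p) := xp :* (yq :+ y′q) :+ xq :* (yp :+ y′p))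
                refl (x p) (x q) (y p) (y q) (y′ p) (y′ q)

  mul-⊛ʳ : ∀ x k y → mul x (k ⊛ y) ≈S (k ·S mul x y)
  mul-⊛ʳ x k y p q with p ≟ q
  ... | yes _ = solve 3 (λ xp k yp → xp :* (k :* yp) := k :* (xp :* yp)) refl (x p) k (y p)
  ... | no _  = solve 5 (λ xp xq k yp yq → xp :* (k :* yq) :+ xq :* (k :* yp) := k :* (xp :* yq :+ xq :* yp))
                  refl (x p) (x q) k (y p) (y q)

  sq-diagonal : ∀ x a → sq x a a ≈ x a * x a
  sq-diagonal x a with a ≟ a
  ... | yes _   = refl
  ... | no a≢a = ⊥-elim (a≢a ≡.refl)

  sq-offDiagonal : ∀ x {a b} → a ≢ b → sq x a b ≈ 0#
  sq-offDiagonal x {a} {b} a≢b with a ≟ b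
  ... | yes a≡b = ⊥-elim (a≢b a≡b)
  ... | no _    = xy+yx≈0 (x a) (x b)

  lincomb-offDiagonal : ∀ cs {a b} → a ≢ b → lincomb cs a b ≈ 0#
  lincomb-offDiagonal []             a≢b = refl
  lincomb-offDiagonal ((k , x) ∷ cs) {a} {b} a≢b = begin
    k * sq x a b + lincomb cs a b  ≈⟨ +-cong (*-congˡ (sq-offDiagonal x a≢b)) (lincomb-offDiagonal cs a≢b) ⟩
    k * 0# + 0#                    ≈⟨ +-identityʳ _ ⟩
    k * 0#                         ≈⟨ zeroʳ k ⟩
    0#                             ∎

  InW2-offDiagonal : ∀ {w} → InW2 w → ∀ {a b} → a ≢ b → w a b ≈ 0#
  InW2-offDiagonal (cs , w≈cs) a≢b = trans (w≈cs _ _) (lincomb-offDiagonal cs a≢b)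

  diagonal-expansion : ∀ (w : S₂) → (∀ {a b} → a ≢ b → w a b ≈ 0#) →
                       ∀ a b → w a b ≈ ∑[ p < 6 ] (w p p * sq (e p) a b)
  diagonal-expansion w offDiagonal a b = by-cases (a ≟ b)
    where
    by-cases : Dec (a ≡ b) → w a b ≈ ∑[ p < 6 ] (w p p * sq (e p) a b)
    by-cases (yes ≡.refl) = sym (begin
      ∑[ p < 6 ] (w p p * sq (e p) a a)  ≈⟨ sum-cong-≋ (λ p → *-congˡ {w p p} (sq-e p)) ⟩
      ∑[ p < 6 ] (w p p * e a p)         ≈⟨ ∑-e (λ p → w p p) a ⟩
      w a a                              ∎)
      where
      sq-e : ∀ p → sq (e p) a a ≈ e a p
      sq-e p = trans (sq-diagonal (e p) a) (trans (bit-idem _) (reflexive (e-comm p a)))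
    by-cases (no a≢b) = trans (offDiagonal a≢b)
      (sym (sum-zero (λ p → w p p * sq (e p) a b) λ p → trans (*-congˡ (sq-offDiagonal (e p) a≢b)) (zeroʳ _)))

  module Duality (χ₀ : Carrier) (χ₀≉0 : ¬ χ₀ ≈ 0#) (φ : Λ²V* → W) (isφ : IsPhi χ₀ φ) where
    open Walks F χ₀ φ public

    κ : Carrier
    κ = χ₀ ⁻¹

    κ-cancel : ∀ y → κ * (χ₀ * y) ≈ y
    κ-cancel y = begin
      κ * (χ₀ * y)  ≈⟨ *-assoc κ χ₀ y ⟨
      κ * χ₀ * y    ≈⟨ *-congʳ (trans (*-comm κ χ₀) (⁻¹-inverse χ₀ χ₀≉0)) ⟩
      1# * y        ≈⟨ *-identityˡ y ⟩
      y             ∎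

    φ-explicit : ∀ a r → φ a r ≈ κ * a (complement r)
    φ-explicit a r = begin
      φ a r                                    ≈⟨ κ-cancel (φ a r) ⟨
      κ * (χ₀ * φ a r)                         ≈⟨ *-congˡ (*-congˡ (top-e r (φ a))) ⟨
      κ * (χ₀ * top (e (complement r)) (φ a))  ≈⟨ *-congˡ (isφ a (e (complement r))) ⟩
      κ * pair a (e (complement r))            ≈⟨ *-congˡ (pair-e a (complement r)) ⟩
      κ * a (complement r)                     ∎

    φ-cong : ∀ {a b} → a ≋ b → φ a ≋ φ b
    φ-cong {a} {b} a≋b r = begin
      φ a r                 ≈⟨ φ-explicit a r ⟩
      κ * a (complement r)  ≈⟨ *-congˡ (a≋b (complement r)) ⟩
      κ * b (complement r)  ≈⟨ φ-explicit b r ⟨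
      φ b r                 ∎

    φ-⊕ : ∀ a b → φ a ⊕ φ b ≋ φ (a ⊕ b)
    φ-⊕ a b r = begin
      φ a r + φ b r                               ≈⟨ +-cong (φ-explicit a r) (φ-explicit b r) ⟩
      κ * a (complement r) + κ * b (complement r) ≈⟨ distribˡ κ _ _ ⟨
      κ * (a (complement r) + b (complement r))   ≈⟨ φ-explicit (a ⊕ b) r ⟨
      φ (a ⊕ b) r                                 ∎

    φ-e : ∀ x p → φ ((χ₀ * x) ⊛ e (complement p)) ≋ x ⊛ e p
    φ-e x p r = begin
      φ ((χ₀ * x) ⊛ e (complement p)) r                 ≈⟨ φ-explicit _ r ⟩
      κ * (χ₀ * x * e (complement p) (complement r))    ≈⟨ *-congˡ (*-congˡ (reflexive (e-complement p r))) ⟩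
      κ * (χ₀ * x * e p r)                              ≈⟨ *-congˡ (*-assoc χ₀ x (e p r)) ⟩
      κ * (χ₀ * (x * e p r))                            ≈⟨ κ-cancel (x * e p r) ⟩
      x * e p r                                         ∎

    mul-φ-⊕ : ∀ w a b → (mul w (φ a) +S mul w (φ b)) ≈S mul w (φ (a ⊕ b))
    mul-φ-⊕ w a b p q = trans (mul-⊕ʳ w (φ a) (φ b) p q) (mul-cong (λ _ → refl) (φ-⊕ a b) p q)

    x≈1⇒x⁻¹≈1 : ∀ {x} → x ≈ 1# → x ⁻¹ ≈ 1#
    x≈1⇒x⁻¹≈1 {x} x≈1 = begin
      x ⁻¹       ≈⟨ *-identityˡ (x ⁻¹) ⟨
      1# * x ⁻¹  ≈⟨ *-congʳ x≈1 ⟨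
      x * x ⁻¹   ≈⟨ ⁻¹-inverse x (λ x≈0 → 1≉0 (trans (sym x≈1) x≈0)) ⟩
      1#         ∎

    volt-normalised : ∀ u v → ev (form u) (vec u) ≈ 1# → ev (form v) (vec v) ≈ 1# →
                volt χ₀ φ u v ≈S mul (wedge (vec u) (vec v)) (φ (wedge (form u) (form v)))
    volt-normalised u v u≈1 v≈1 p q =
      trans (*-congʳ (trans (*-cong (x≈1⇒x⁻¹≈1 u≈1) (x≈1⇒x⁻¹≈1 v≈1)) (*-identityˡ 1#)))
            (*-identityˡ _)

    volt-sym : ∀ u v → volt χ₀ φ v u ≈S volt χ₀ φ u v
    volt-sym u v p q =
      *-cong (*-comm _ _) (mul-cong (wedge-antisym (vec u) (vec v)) (φ-cong (wedge-antisym (form u) (form v))) p q)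

    ClosedWalk-detour : ∀ {u v A} → Adj u v → ClosedWalk v A → ClosedWalk u A
    ClosedWalk-detour {u} {v} {A} uv (us , linked , voltage) =
      closed-walk (v ∷ us ++ [ v ]) (≡.cong (λ zs → u ∷ v ∷ zs) (≡.sym (++-assoc us [ v ] [ u ])))
        (Linked-join (u ∷ v ∷ us) [ u ] (uv ∷ linked) (swap uv ∷ [-]))
        λ p q → begin
          walkVolt χ₀ φ ((u ∷ v ∷ us) ++ v ∷ [ u ]) p q
            ≈⟨ walkVolt-++ (u ∷ v ∷ us) v [ u ] p q ⟩
          (volt χ₀ φ u v p q + walkVolt χ₀ φ (closedWalk v us) p q) + (volt χ₀ φ v u p q + 0#)
            ≈⟨ +-congˡ (+-congʳ (volt-sym u v p q)) ⟩
          (volt χ₀ φ u v p q + walkVolt χ₀ φ (closedWalk v us) p q) + (volt χ₀ φ u v p q + 0#)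
            ≈⟨ solve 2 (λ x y → (x :+ y) :+ (x :+ 𝟘) := y) refl _ _ ⟩
          walkVolt χ₀ φ (closedWalk v us) p q
            ≈⟨ voltage p q ⟩
          A p q ∎

    normalisedVertex : (v : V) (f : V*) → ev f v ≈ 1# → Vertex
    normalisedVertex v f f[v]≈1 = mkV v f (λ f[v]≈0 → 1≉0 (trans (sym f[v]≈1) f[v]≈0))

    ClosedWalk-quadrilateral : ∀ a b α β γ δ (αa : ev α a ≈ 1#) → ev β b ≈ 1# →
                               ev α b ≈ 0# → ev β a ≈ 0# →
                               ev γ a ≈ 0# → ev γ b ≈ 0# → ev δ a ≈ 0# → ev δ b ≈ 0# →
                               ClosedWalk (normalisedVertex a α αa) (mul (wedge a b) (φ (wedge γ δ)))
    ClosedWalk-quadrilateral a b α β γ δ αa βb αb βa γa γb δa δb =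
      u₂ ∷ u₃ ∷ u₄ ∷ [] , (αb , βa) ∷ (βa , αγb) ∷ (αγb , βδa) ∷ (βδa , αb) ∷ [-] , voltage
      where
      αγa : ev (α ⊕ γ) a ≈ 1#
      αγa = trans (ev-⊕ˡ α γ a) (trans (+-cong αa γa) (+-identityʳ 1#))
      αγb : ev (α ⊕ γ) b ≈ 0#
      αγb = trans (ev-⊕ˡ α γ b) (trans (+-cong αb γb) (+-identityʳ 0#))
      βδa : ev (β ⊕ δ) a ≈ 0#
      βδa = trans (ev-⊕ˡ β δ a) (trans (+-cong βa δa) (+-identityʳ 0#))
      βδb : ev (β ⊕ δ) b ≈ 1#
      βδb = trans (ev-⊕ˡ β δ b) (trans (+-cong βb δb) (+-identityʳ 1#))
      u₁ u₂ u₃ u₄ : Vertex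
      u₁ = normalisedVertex a α αa
      u₂ = normalisedVertex b β βb
      u₃ = normalisedVertex a (α ⊕ γ) αγa
      u₄ = normalisedVertex b (β ⊕ δ) βδb
      ab = wedge a b
      ba≋ab = wedge-antisym a b
      voltage : walkVolt χ₀ φ (u₁ ∷ u₂ ∷ u₃ ∷ u₄ ∷ u₁ ∷ []) ≈S mul ab (φ (wedge γ δ))
      voltage p q = begin
        volt χ₀ φ u₁ u₂ p q + (volt χ₀ φ u₂ u₃ p q + (volt χ₀ φ u₃ u₄ p q + (volt χ₀ φ u₄ u₁ p q + 0#)))
          ≈⟨ +-cong (volt-normalised u₁ u₂ αa βb p q)
            (+-cong (trans (volt-normalised u₂ u₃ βb αγa p q) (mul-cong ba≋ab (λ _ → refl) p q))
            (+-cong (volt-normalised u₃ u₄ αγa βδb p q)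
            (trans (+-identityʳ _)
                   (trans (volt-normalised u₄ u₁ βδb αa p q) (mul-cong ba≋ab (λ _ → refl) p q))))) ⟩
        mul ab (φ c₁) p q + (mul ab (φ c₂) p q + (mul ab (φ c₃) p q + mul ab (φ c₄) p q))
          ≈⟨ +-congˡ (+-congˡ (mul-φ-⊕ ab c₃ c₄ p q)) ⟩
        mul ab (φ c₁) p q + (mul ab (φ c₂) p q + mul ab (φ (c₃ ⊕ c₄)) p q)
          ≈⟨ +-congˡ (mul-φ-⊕ ab c₂ (c₃ ⊕ c₄) p q) ⟩
        mul ab (φ c₁) p q + mul ab (φ (c₂ ⊕ (c₃ ⊕ c₄))) p q
          ≈⟨ mul-φ-⊕ ab c₁ (c₂ ⊕ (c₃ ⊕ c₄)) p q ⟩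
        mul ab (φ (c₁ ⊕ (c₂ ⊕ (c₃ ⊕ c₄)))) p q
          ≈⟨ mul-cong (λ _ → refl) (φ-cong (wedge-quadrilateral α β γ δ)) p q ⟩
        mul ab (φ (wedge γ δ)) p q ∎
        where
        c₁ = wedge α β
        c₂ = wedge β (α ⊕ γ)
        c₃ = wedge (α ⊕ γ) (β ⊕ δ)
        c₄ = wedge (β ⊕ δ) α

    basisVertex : Fin 4 → Vertex
    basisVertex s = normalisedVertex (e s) (e s) (ev-e-self s)

    basisVertex-adj : ∀ {s t} → s ≢ t → Adj (basisVertex s) (basisVertex t)
    basisVertex-adj s≢t = ev-e-≢ s≢t , ev-e-≢ (s≢t ∘ ≡.sym)

    -- Based at the larger index of p, which is never 0, so that e₀ ⊗ e₀* is adjacent to it.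
    ClosedWalk-e² : ∀ p x → ClosedWalk (basisVertex (pr₂ p)) (x ·S sq (e p))
    ClosedWalk-e² p x =
      let i≢j , k≢i , k≢j , l≢i , l≢j = complement-distinct p in
      ClosedWalk-cong
        (ClosedWalk-quadrilateral (e j) (e i) (e j) (e i) γ (e l) (ev-e-self j) (ev-e-self i)
          (ev-e-≢ (i≢j ∘ ≡.sym)) (ev-e-≢ i≢j)
          (γ-vanishes k≢j) (γ-vanishes k≢i) (ev-e-≢ l≢j) (ev-e-≢ l≢i))
        voltage
      where
      i = pr₁ p
      j = pr₂ p
      k = pr₁ (complement p)
      l = pr₂ (complement p)
      γ = (χ₀ * x) ⊛ e k
      γ-vanishes : ∀ {t} → k ≢ t → ev γ (e t) ≈ 0#
      γ-vanishes {t} k≢t = trans (ev-e γ t) (trans (*-congˡ (reflexive (e-≢ k≢t))) (zeroʳ _))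
      γ∧l≋ : wedge γ (e l) ≋ (χ₀ * x) ⊛ e (complement p)
      γ∧l≋ t = trans (wedge-⊛ˡ (χ₀ * x) (e k) (e l) t) (*-congˡ (wedge-e (complement p) t))
      voltage : mul (wedge (e j) (e i)) (φ (wedge γ (e l))) ≈S (x ·S sq (e p))
      voltage a b = begin
        mul (wedge (e j) (e i)) (φ (wedge γ (e l))) a b
          ≈⟨ mul-cong (λ t → trans (wedge-antisym (e i) (e j) t) (wedge-e p t))
                      (λ t → trans (φ-cong γ∧l≋ t) (φ-e x p t)) a b ⟩
        mul (e p) (x ⊛ e p) a b
          ≈⟨ mul-⊛ʳ (e p) x (e p) a b ⟩
        x * sq (e p) a b ∎

    ClosedWalk-diagonal : ∀ (d : Fin 6 → Carrier) → ClosedWalk (basisVertex 0F) (∑S (λ p → d p ·S sq (e p)))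
    ClosedWalk-diagonal d = ClosedWalk-∑ (λ p → d p ·S sq (e p)) λ p →
      ClosedWalk-detour (basisVertex-adj (pr₂≢0 p)) (ClosedWalk-e² p (d p))

lemma3p12 : ∀ {c ℓ : Level} (F : Field c ℓ) →
    Setup.Char2 F →
    (χ₀ : Field.Carrier F) → ¬ (Field._≈_ F χ₀ (Field.0# F)) →
    (φ : Setup.Λ²V* F → Setup.W F) → Setup.IsPhi F χ₀ φ →
    (w : Setup.S₂ F) → Setup.InW2 F w →
    Setup.HasCycleWithVoltage F χ₀ φ w
lemma3p12 F char2 χ₀ χ₀≉0 φ isφ w w∈W⁽²⁾ =
  basisVertex 0F ,
  ClosedWalk-cong (ClosedWalk-diagonal (λ p → w p p))
    (λ a b → sym (diagonal-expansion w (InW2-offDiagonal w∈W⁽²⁾) a b))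
  where
  open Field F using (sym)
  open Char2 F char2
  open Duality χ₀ χ₀≉0 φ isφ
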